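{- Let $L$ be a complete lattice and let $f,g_0,g_1,\dots\in\mathrm{FinAdd}_L$ be locally $^*$-closed and $\top$-continuous, such that for each $m\ge0$ the map $g_m\prod_{n\ge m+1}f^*g_n\in\mathrm{FinAdd}_{L,\mathbf 2}$ is $\top$-continuous. Then $$\prod_{n\ge0}f^*g_n=\bigvee_{k_0,k_1,\dots\ge0}\prod_{n\ge0}f^{k_n}g_n.$$
   Context: Functions are written on the right and composed left to right: $xf$ is $f$ applied to $x$, $fg$ means "first $f$, then $g$". $\mathbf 2=\{\bot,\top\}$, $\bot<\top$. For complete lattices $L,L'$, $f:L\to L'$ is finitely additive if $\bot f=\bot$ and $(x\vee y)f=xf\vee yf$; $\mathrm{FinAdd}_{L,L'}$ is the set of these, ordered pointwise with pointwise suprema; $\mathrm{FinAdd}_L=\mathrm{FinAdd}_{L,L}$. $f^0=\mathrm{id}$, $f^{n+1}=f^nf$, $f^*=\bigvee_nf^n$ (pointwise). A map $h\in\mathrm{FinAdd}_{L,L'}$ is $\top$-continuous if $h$ is the constant $\bot$ map or for every $X\subseteq L$ with $\bigvee X=\top$, $\bigvee_{x\in X}xh=\top$. $f\in\mathrm{FinAdd}_L$ is locally $^*$-closed if for each $x\in L$ either $xf^*=\top$ or $xf^*=x\vee xf\vee\dots\vee xf^N$ for some $N\ge0$. For $h_0,h_1,\dots\in\mathrm{FinAdd}_L$, $\prod_{n\ge0}h_n:L\to\mathbf 2$ sends $x$ to $\bot$ if $xh_0\cdots h_n=\bot$ for some $n$, and to $\top$ otherwise; $\prod_{n\ge m}h_n$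 means $\prod_{n\ge0}h_{n+m}$, and $g\prod_{n\ge m}h_n$ is the composite "first $g$, then $\prod_{n\ge m}h_n$". The supremum on the right ranges over all sequences of nonnegative integers and is pointwise. -}

module Defs where

open import Level using (Level; Lift; lift; lower; _⊔_) renaming (suc to lsuc)
open import Data.Nat using (ℕ; zero; suc; _+_)
open import Data.Fin using (Fin; toℕ)
open import Data.Bool using (Bool; true; false; if_then_else_)
open import Data.Empty using (⊥)
open import Data.Product using (Σ; _×_; _,_; proj₁; proj₂)
open import Data.Sum using (_⊎_)
open import Relation.Nullary using (¬_)
open import Relation.Binary.PropositionalEquality using (_≡_)
open import Relation.Binary.Structures using (IsPartialOrder)

-- A complete lattice: a partially ordered set (equality is propositional
-- equality on the carrier) in which every family indexed by a type in
-- Set c (in particular every subset  X : Carrier → Set c) has a supremum.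
record CompleteLattice (c ℓ : Level) : Set (lsuc (c ⊔ ℓ)) where
  field
    Carrier        : Set c
    _≤_            : Carrier → Carrier → Set ℓ
    isPartialOrder : IsPartialOrder _≡_ _≤_
    ⋁              : {I : Set c} → (I → Carrier) → Carrier
    ⋁-upper        : {I : Set c} (u : I → Carrier) (i : I) → u i ≤ ⋁ u
    ⋁-least        : {I : Set c} (u : I → Carrier) (z : Carrier) →
                     ((i : I) → u i ≤ z) → ⋁ u ≤ z

  ⋁ₛ : (Carrier → Set c) → Carrier
  ⋁ₛ X = ⋁ {Σ Carrier X} proj₁

  ⊥L : Carrier
  ⊥L = ⋁ {Lift c ⊥} (λ ())

  ⊤L : Carrier
  ⊤L = ⋁ {Carrier} (λ x → x)

  _∨_ : Carrier → Carrier → Carrier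
  x ∨ y = ⋁ {Lift c Bool} (λ b → if lower b then x else y)

module _ {c ℓ : Level} (L : CompleteLattice c ℓ) where
  open CompleteLattice L

  -- maps L → L; composition "fg" (first f, then g) is  g ∘ f
  Endo : Set c
  Endo = Carrier → Carrier

  IsFinAdd : Endo → Set c
  IsFinAdd h = (h ⊥L ≡ ⊥L) × (∀ x y → h (x ∨ y) ≡ h x ∨ h y)

  pow : Endo → ℕ → Endo
  pow f zero    x = x
  pow f (suc n) x = f (pow f n x)

  star : Endo → Endo
  star f x = ⋁ {Lift c ℕ} (λ n → pow f (lower n) x)

  partialStar : Endo → ℕ → Endo
  partialStar f N x = ⋁ {Lift c (Fin (suc N))} (λ i → pow f (toℕ (lower i)) x)

  LocallyStarClosed : Endo → Set c
  LocallyStarClosed f =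
    ∀ x → (star f x ≡ ⊤L) ⊎ Σ ℕ (λ N → star f x ≡ partialStar f N x)

  TopContinuous : Endo → Set (lsuc c)
  TopContinuous h =
    (∀ x → h x ≡ ⊥L) ⊎
    (∀ (X : Carrier → Set c) → ⋁ₛ X ≡ ⊤L →
       ⋁ {Σ Carrier X} (λ p → h (proj₁ p)) ≡ ⊤L)

  -- A map L → 2 is represented by the predicate "its value is ⊤".
  -- ⊤-continuity of a map L → 2: constant ⊥, or for every X with ⋁X = ⊤
  -- the supremum in 2 of the values on X is ⊤, i.e. some x ∈ X is sent to ⊤.
  TopContinuous₂ : (Carrier → Set c) → Set (lsuc c)
  TopContinuous₂ h =
    (∀ x → ¬ h x) ⊎
    (∀ (X : Carrier → Set c) → ⋁ₛ X ≡ ⊤L → Σ (Σ Carrier X) (λ p → h (proj₁ p)))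

  chain : (ℕ → Endo) → ℕ → Endo
  chain hs zero    x = hs zero x
  chain hs (suc n) x = hs (suc n) (chain hs n x)

  -- ∏_{n≥0} h_n : L → 2, as the predicate "value is ⊤":
  -- x ↦ ⊥ iff x h_0 ⋯ h_n = ⊥ for some n
  Prod : (ℕ → Endo) → Carrier → Set c
  Prod hs x = ∀ n → ¬ (chain hs n x ≡ ⊥L)

  ProdFrom : ℕ → (ℕ → Endo) → Carrier → Set c
  ProdFrom m hs = Prod (λ n → hs (n + m))

-- (⇐) is monotonicity: f^k ≤ f^*, and every map involved is monotone.
--
-- (⇒) builds k one index at a time.  Write H n = f^* g_n.  Classically, for
-- a family of ⊥-preserving, join-subadditive maps, the product ∏ h_n is a
-- PRIME predicate: it holds at a ∨ b only if it holds at a or at b (if both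
-- chains reach ⊥, they do so together at the later step).  The key general
-- lemma  starWitness  says: if P is a prime, ⊤-continuous predicate and f is
-- locally *-closed, then  P (y f^*)  implies  P (y f^k)  for some k.  Either
-- y f^* is a finite join  y ∨ … ∨ y f^N  and primality picks a summand, or
-- y f^* = ⊤ = ⋁_k y f^k and ⊤-continuity picks a k.  Applied to
-- P = g_m ∏_{n≥m+1} H n, this turns "y satisfies ∏_{n≥m} H n" into
-- "y f^{k_m} g_m satisfies ∏_{n≥m+1} H n", which is the induction step.
-- Finally, the chain  x f^{k_0} g_0 ⋯ f^{k_n} g_n  is never ⊥, because it
-- still satisfies the tail product and H preserves ⊥.
module Submission where

open import Defs
open import Level using (Level; _⊔_; Lift; lift; lower)
open import Axiom.ExcludedMiddle using (ExcludedMiddle)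
open import Data.Nat using (ℕ; zero; suc; _+_; _≤′_; ≤′-refl; ≤′-step)
  renaming (_≤_ to _≤ℕ_; _⊔_ to _⊔ℕ_)
import Data.Nat.Properties as ℕ
open import Data.Fin using (toℕ)
open import Data.Fin.Properties using (toℕ≤pred[n])
open import Data.Bool using (true; false)
open import Data.Empty using (⊥-elim)
open import Data.Product using (Σ; _,_; proj₁; proj₂)
open import Data.Sum using (_⊎_; inj₁; inj₂)
open import Function.Bundles using (_⇔_; mk⇔)
open import Relation.Nullary using (¬_; Dec; yes; no)
open import Relation.Binary.PropositionalEquality using (_≡_; refl; sym; trans; cong; subst)
open import Relation.Binary.Structures using (IsPartialOrder)

module Lattice {c ℓ : Level} (L : CompleteLattice c ℓ) where
  open CompleteLattice L
  open IsPartialOrder isPartialOrder public using (reflexive; antisym)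
    renaming (trans to ≤-trans)

  ≤-refl : ∀ {a} → a ≤ a
  ≤-refl = reflexive refl

  ≤⊥⇒≡⊥ : ∀ {a} → a ≤ ⊥L → a ≡ ⊥L
  ≤⊥⇒≡⊥ p = antisym p (⋁-least (λ ()) _ (λ ()))

  ∨-upperˡ : ∀ a b → a ≤ (a ∨ b)
  ∨-upperˡ a b = ⋁-upper _ (lift true)

  ∨-upperʳ : ∀ a b → b ≤ (a ∨ b)
  ∨-upperʳ a b = ⋁-upper _ (lift false)

  ∨-least : ∀ {a b z} → a ≤ z → b ≤ z → (a ∨ b) ≤ z
  ∨-least {a} {b} {z} a≤z b≤z = ⋁-least _ z λ { (lift true) → a≤z ; (lift false) → b≤z }

  ∨-mono : ∀ {a b a' b'} → a ≤ a' → b ≤ b' → (a ∨ b) ≤ (a' ∨ b')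
  ∨-mono p q = ∨-least (≤-trans p (∨-upperˡ _ _)) (≤-trans q (∨-upperʳ _ _))

  -- The properties of finitely additive maps the argument really uses;
  -- unlike additivity they are inherited by f^* (a supremum of maps).
  record IsSubadditive (φ : Endo L) : Set (c ⊔ ℓ) where
    field
      preserves-⊥ : φ ⊥L ≡ ⊥L
      monotone    : ∀ {a b} → a ≤ b → φ a ≤ φ b
      subadditive : ∀ a b → φ (a ∨ b) ≤ (φ a ∨ φ b)
  open IsSubadditive

  finAdd⇒subadditive : ∀ {φ} → IsFinAdd L φ → IsSubadditive φ
  finAdd⇒subadditive {φ} (φ⊥ , φ∨) = record
    { preserves-⊥ = φ⊥
    ; monotone    = mono
    ; subadditive = λ a b → reflexive (φ∨ a b)
    }
    where
    -- a ≤ b means a ∨ b = b, so φ a ≤ φ a ∨ φ b = φ (a ∨ b) = φ b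
    mono : ∀ {a b} → a ≤ b → φ a ≤ φ b
    mono {a} {b} a≤b =
      subst (λ z → φ a ≤ φ z) (antisym (∨-least a≤b ≤-refl) (∨-upperʳ a b))
        (subst (φ a ≤_) (sym (φ∨ a b)) (∨-upperˡ _ _))

  ∘-subadditive : ∀ {φ ψ} → IsSubadditive φ → IsSubadditive ψ →
                  IsSubadditive (λ x → ψ (φ x))
  ∘-subadditive {φ} {ψ} sφ sψ = record
    { preserves-⊥ = trans (cong ψ (preserves-⊥ sφ)) (preserves-⊥ sψ)
    ; monotone    = λ p → monotone sψ (monotone sφ p)
    ; subadditive = λ a b → ≤-trans (monotone sψ (subadditive sφ a b)) (subadditive sψ _ _)
    }

  pow-subadditive : ∀ {f} → IsSubadditive f → ∀ k → IsSubadditive (pow L f k)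
  pow-subadditive sf zero    = record
    { preserves-⊥ = refl ; monotone = λ p → p ; subadditive = λ _ _ → ≤-refl }
  pow-subadditive sf (suc k) = ∘-subadditive (pow-subadditive sf k) sf

  pow≤star : ∀ f k a → pow L f k a ≤ star L f a
  pow≤star f k a = ⋁-upper (λ n → pow L f (lower n) a) (lift k)

  star-subadditive : ∀ {f} → IsSubadditive f → IsSubadditive (star L f)
  star-subadditive {f} sf = record
    { preserves-⊥ = ≤⊥⇒≡⊥ (⋁-least _ _ λ k → reflexive (preserves-⊥ (sfᵏ k)))
    ; monotone    = λ p → ⋁-least _ _ λ k →
                      ≤-trans (monotone (sfᵏ k) p) (pow≤star f (lower k) _)
    ; subadditive = λ a b → ⋁-least _ _ λ k →
                      ≤-trans (subadditive (sfᵏ k) a b)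
                              (∨-mono (pow≤star f (lower k) a) (pow≤star f (lower k) b))
    }
    where
    sfᵏ : (k : Lift c ℕ) → IsSubadditive (pow L f (lower k))
    sfᵏ k = pow-subadditive sf (lower k)

  powJoin : Endo L → ℕ → Endo L
  powJoin f zero    y = y
  powJoin f (suc N) y = powJoin f N y ∨ pow L f (suc N) y

  pow≤powJoin : ∀ f N y i → i ≤ℕ N → pow L f i y ≤ powJoin f N y
  pow≤powJoin f zero    y zero _ = ≤-refl
  pow≤powJoin f (suc N) y i i≤1+N with ℕ.m≤n⇒m<n∨m≡n i≤1+N
  ... | inj₁ i<1+N = ≤-trans (pow≤powJoin f N y i (ℕ.≤-pred i<1+N)) (∨-upperˡ _ _)
  ... | inj₂ refl  = ∨-upperʳ _ _

  powJoin≤star : ∀ f N y → powJoin f N y ≤ star L f y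
  powJoin≤star f zero    y = pow≤star f zero y
  powJoin≤star f (suc N) y = ∨-least (powJoin≤star f N y) (pow≤star f (suc N) y)

  partialStar≡powJoin : ∀ f N y → star L f y ≡ partialStar L f N y →
                        star L f y ≡ powJoin f N y
  partialStar≡powJoin f N y e = antisym
    (≤-trans (reflexive e)
      (⋁-least _ _ λ i → pow≤powJoin f N y (toℕ (lower i)) (toℕ≤pred[n] (lower i))))
    (powJoin≤star f N y)

  orbit : Endo L → Carrier → Carrier → Set c
  orbit f y z = Σ (Lift c ℕ) λ k → z ≡ pow L f (lower k) y

  ⋁orbit≡star : ∀ f y → ⋁ₛ (orbit f y) ≡ star L f y
  ⋁orbit≡star f y = antisym
    (⋁-least _ _ λ { (z , k , refl) → pow≤star f (lower k) y })
    (⋁-least _ _ λ k → ⋁-upper proj₁ (pow L f (lower k) y , k , refl))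

  Prime : (Carrier → Set c) → Set c
  Prime P = ∀ a b → P (a ∨ b) → P a ⊎ P b

  powJoinWitness : ∀ (P : Carrier → Set c) → Prime P →
                   ∀ f N y → P (powJoin f N y) → Σ ℕ λ k → P (pow L f k y)
  powJoinWitness P prime f zero    y p = zero , p
  powJoinWitness P prime f (suc N) y p with prime _ _ p
  ... | inj₁ pJ = powJoinWitness P prime f N y pJ
  ... | inj₂ pf = suc N , pf

  starWitness : ∀ (P : Carrier → Set c) → Prime P → TopContinuous₂ L P →
                ∀ {f} → LocallyStarClosed L f →
                ∀ y → P (star L f y) → Σ ℕ λ k → P (pow L f k y)
  starWitness P prime cont {f} closed y p with closed y
  ... | inj₂ (N , e) = powJoinWitness P prime f N y (subst P (partialStar≡powJoin f N y e) p)
  ... | inj₁ y*≡⊤ with cont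
  ...   | inj₁ never = ⊥-elim (never _ p)
  ...   | inj₂ cover with cover (orbit f y) (trans (⋁orbit≡star f y) y*≡⊤)
  ...     | ((_ , k , refl) , pk) = lower k , pk

  Prod-ext : ∀ {hs hs'} → (∀ n a → hs n a ≡ hs' n a) → ∀ {a} → Prod L hs a → Prod L hs' a
  Prod-ext {hs} {hs'} e {a} p n = λ chain'≡⊥ → p n (trans (chain≡ n) chain'≡⊥)
    where
    chain≡ : ∀ n → chain L hs n a ≡ chain L hs' n a
    chain≡ zero    = e zero a
    chain≡ (suc n) = trans (cong (hs (suc n)) (chain≡ n)) (e (suc n) _)

  Prod-tail : ∀ hs {a} → Prod L hs a → Prod L (λ i → hs (suc i)) (hs zero a)
  Prod-tail hs {a} p n = λ e → p (suc n) (trans (chain-tail n) e)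
    where
    chain-tail : ∀ n → chain L hs (suc n) a ≡ chain L (λ i → hs (suc i)) n (hs zero a)
    chain-tail zero    = refl
    chain-tail (suc n) = cong (hs (suc (suc n))) (chain-tail n)

  Prod⇒≢⊥ : ∀ {hs a} → hs zero ⊥L ≡ ⊥L → Prod L hs a → ¬ (a ≡ ⊥L)
  Prod⇒≢⊥ h₀⊥ p refl = p zero h₀⊥

  chain-subadditive : ∀ {hs} → (∀ n → IsSubadditive (hs n)) →
                      ∀ n → IsSubadditive (chain L hs n)
  chain-subadditive s zero    = s zero
  chain-subadditive s (suc n) = ∘-subadditive (chain-subadditive s n) (s (suc n))

  chain-mono : ∀ {hs hs'} → (∀ n a → hs n a ≤ hs' n a) → (∀ n → IsSubadditive (hs' n)) →
               ∀ n a → chain L hs n a ≤ chain L hs' n a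
  chain-mono le s zero    a = le zero a
  chain-mono le s (suc n) a = ≤-trans (le (suc n) _) (monotone (s (suc n)) (chain-mono le s n a))

  chain-⊥-later : ∀ {hs} → (∀ n → IsSubadditive (hs n)) →
                  ∀ {n m a} → n ≤′ m → chain L hs n a ≡ ⊥L → chain L hs m a ≡ ⊥L
  chain-⊥-later s ≤′-refl       e = e
  chain-⊥-later {hs} s {m = suc m} (≤′-step n≤m) e =
    trans (cong (hs (suc m)) (chain-⊥-later s n≤m e)) (preserves-⊥ (s (suc m)))

  chain-∨-⊥ : ∀ {hs} → (∀ n → IsSubadditive (hs n)) → ∀ {n m a b} →
              chain L hs n a ≡ ⊥L → chain L hs m b ≡ ⊥L → chain L hs (n ⊔ℕ m) (a ∨ b) ≡ ⊥L
  chain-∨-⊥ s {n} {m} {a} {b} ea eb = ≤⊥⇒≡⊥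
    (≤-trans (subadditive (chain-subadditive s (n ⊔ℕ m)) a b)
      (∨-least (reflexive (chain-⊥-later s (ℕ.≤⇒≤′ (ℕ.m≤m⊔n n m)) ea))
               (reflexive (chain-⊥-later s (ℕ.≤⇒≤′ (ℕ.m≤n⊔m n m)) eb))))

  module Classical (em : ExcludedMiddle (c ⊔ ℓ)) where
    decide : (A : Set c) → Dec A
    decide A with em {Lift ℓ A}
    ... | yes (lift a) = yes a
    ... | no ¬a        = no (λ a → ¬a (lift a))

    ¬Prod⇒chain⊥ : ∀ hs a → ¬ Prod L hs a → Σ ℕ λ n → chain L hs n a ≡ ⊥L
    ¬Prod⇒chain⊥ hs a ¬p with decide (Σ (Lift c ℕ) λ n → chain L hs (lower n) a ≡ ⊥L)
    ... | yes (n , e) = lower n , e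
    ... | no ¬∃       = ⊥-elim (¬p (λ n e → ¬∃ (lift n , e)))

    Prod-prime : ∀ {hs} → (∀ n → IsSubadditive (hs n)) → Prime (Prod L hs)
    Prod-prime {hs} s a b p with decide (Prod L hs a) | decide (Prod L hs b)
    ... | yes pa | _      = inj₁ pa
    ... | no ¬pa | yes pb = inj₂ pb
    ... | no ¬pa | no ¬pb with ¬Prod⇒chain⊥ hs a ¬pa | ¬Prod⇒chain⊥ hs b ¬pb
    ...   | n , ea | m , eb = ⊥-elim (p (n ⊔ℕ m) (chain-∨-⊥ s {n} {m} {a} {b} ea eb))

module Theorem {c ℓ : Level} (em : ExcludedMiddle (c ⊔ ℓ)) (L : CompleteLattice c ℓ)
  (f : Endo L) (g : ℕ → Endo L)
  (f-add : IsFinAdd L f) (f-closed : LocallyStarClosed L f)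
  (g-add : ∀ n → IsFinAdd L (g n))
  (tail-cont : ∀ m → TopContinuous₂ L
     (λ x → ProdFrom L (suc m) (λ n y → g n (star L f y)) (g m x))) where
  open CompleteLattice L
  open Lattice L
  open IsSubadditive
  open Classical em

  H : ℕ → Endo L
  H n y = g n (star L f y)

  H-subadditive : ∀ n → IsSubadditive (H n)
  H-subadditive n = ∘-subadditive (star-subadditive (finAdd⇒subadditive f-add))
                                  (finAdd⇒subadditive (g-add n))

  Tail : ℕ → Carrier → Set c
  Tail m x = ProdFrom L (suc m) H (g m x)

  Tail-prime : ∀ m → Prime (Tail m)
  Tail-prime m a b t =
    Prod-prime (λ n → H-subadditive (n + suc m)) (g m a) (g m b)
      (subst (ProdFrom L (suc m) H) (proj₂ (g-add m) a b) t)

  ProdFrom⇒Tail : ∀ m y → ProdFrom L m H y → Tail m (star L f y)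
  ProdFrom⇒Tail m y p =
    Prod-ext (λ n a → cong (λ j → H j a) (sym (ℕ.+-suc n m))) (Prod-tail (λ n → H (n + m)) p)

  choose : ∀ m y → ProdFrom L m H y → Σ ℕ λ k → Tail m (pow L f k y)
  choose m y p = starWitness (Tail m) (Tail-prime m) (tail-cont m) f-closed y (ProdFrom⇒Tail m y p)

  module Forward (x : Carrier) (x∈∏H : Prod L H x) where
    -- position m of the path:  x f^{k_0} g_0 ⋯ f^{k_{m-1}} g_{m-1} ∈ ∏_{n≥m} H n
    path : (m : ℕ) → Σ Carrier (ProdFrom L m H)
    path zero    = x , Prod-ext (λ n a → cong (λ j → H j a) (sym (ℕ.+-identityʳ n))) x∈∏H
    path (suc m) with choose m (proj₁ (path m)) (proj₂ (path m))
    ... | k , t = g m (pow L f k (proj₁ (path m))) , t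

    k : ℕ → ℕ
    k m = proj₁ (choose m (proj₁ (path m)) (proj₂ (path m)))

    G : ℕ → Endo L
    G n y = g n (pow L f (k n) y)

    chain≡path : ∀ n → chain L G n x ≡ proj₁ (path (suc n))
    chain≡path zero    = refl
    chain≡path (suc n) = cong (G (suc n)) (chain≡path n)

    x∈∏G : Prod L G x
    x∈∏G n e = Prod⇒≢⊥ {hs = λ i → H (i + suc n)} (preserves-⊥ (H-subadditive (suc n)))
                 (proj₂ (path (suc n))) (trans (sym (chain≡path n)) e)

  backward : ∀ x → Σ (ℕ → ℕ) (λ k → Prod L (λ n y → g n (pow L f (k n) y)) x) → Prod L H x
  backward x (k , p) n e = p n (≤⊥⇒≡⊥ (≤-trans
    (chain-mono (λ n a → monotone (finAdd⇒subadditive (g-add n)) (pow≤star f (k n) a))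
                H-subadditive n x)
    (reflexive e)))

mainTheorem14 : ∀ {c ℓ : Level} → ExcludedMiddle (c ⊔ ℓ) →
    (L : CompleteLattice c ℓ) →
    (f : Endo L) → (g : ℕ → Endo L) →
    IsFinAdd L f → LocallyStarClosed L f → TopContinuous L f →
    (∀ n → IsFinAdd L (g n)) → (∀ n → LocallyStarClosed L (g n)) →
    (∀ n → TopContinuous L (g n)) →
    (∀ m → TopContinuous₂ L
       (λ x → ProdFrom L (suc m) (λ n y → g n (star L f y)) (g m x))) →
    ∀ x → Prod L (λ n y → g n (star L f y)) x
          ⇔ Σ (ℕ → ℕ) (λ k → Prod L (λ n y → g n (pow L f (k n) y)) x)
mainTheorem14 em L f g f-add f-closed _ g-add _ _ tail-cont x =
  mk⇔ (λ p → Forward.k x p , Forward.x∈∏G x p) (backward x)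
  where open Theorem em L f g f-add f-closed g-add tail-cont
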